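{- Let $D=(V,A)$ be a directed acyclic graph with single source $s$ and unit-capacity arcs, let $f:A\to\{0,1,\dots,k\}$, and let $g$ be a fan-extension of $f$. If for some node $v\ne s$ and some integer $i$ with $g(v)<i\le k$ there exists an $i$-fan of $v$ (with respect to $f$ and $g$), then the function $g'$ obtained from $g$ by setting $g'(v)=i$ and $g'(u)=g(u)$ for $u\ne v$ is also a fan-extension of $f$.
   Context: Convention: functions $g:V\to\{0,\dots,k\}$ considered satisfy $g(s)=k$ (the source knows all layers). A path with arcs $a_1,\dots,a_r$ is monotone (w.r.t. $f$) if $f(a_1)\le\dots\le f(a_r)$; $\min(P)=f(a_1)$, $\max(P)=f(a_r)$. Given $g:V\to\{0,\dots,k\}$ and $v\ne s$, an $i$-fan of $v$ consists of $i$ pairwise arc-disjoint monotone paths $P_1,\dots,P_i$ with at least one arc each, ending at $v$, such that for all $j\le i$: $j\le\min(P_j)\le\max(P_j)\le i$ and $P_j$ starts at a node $v_j$ with $g(v_j)\ge\min(P_j)$. $g$ is a fan-extension of $f$ if (i) every $v\ne s$ with $g(v)>0$ has a $g(v)$-fan, and (ii) for every arc $vw$, either $f(vw)\le g(v)$ or some arc $uv$ entering $v$ has $f(uv)=f(vw)$. -}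

module Defs where

open import Data.Nat using (ℕ; zero; suc; _≤_; _<_)
open import Data.Fin using (Fin; toℕ; _≟_)
open import Data.List using (List)
open import Data.List.NonEmpty using (List⁺; _∷_; toList; last)
open import Data.List.Relation.Unary.Linked using (Linked)
open import Data.List.Membership.Propositional using (_∈_; _∉_)
open import Data.Product using (Σ; ∃; _×_; _,_)
open import Data.Sum using (_⊎_)
open import Relation.Binary.PropositionalEquality using (_≡_; _≢_)
open import Relation.Nullary using (¬_; yes; no)

-- Arcs have unit capacity (a path may
-- use each arc at most once; fans are arc-disjoint).
record Digraph (n m : ℕ) : Set where
  field
    tl : Fin m → Fin n
    hd : Fin m → Fin n

module _ {n m : ℕ} (D : Digraph n m) where
  open Digraph D

  Consecutive : Fin m → Fin m → Set
  Consecutive a b = hd a ≡ tl b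

  IsWalk : List⁺ (Fin m) → Set
  IsWalk p = Linked Consecutive (toList p)

  first : List⁺ (Fin m) → Fin m
  first (a ∷ _) = a

  start : List⁺ (Fin m) → Fin n
  start p = tl (first p)

  end : List⁺ (Fin m) → Fin n
  end p = hd (last p)

  Acyclic : Set
  Acyclic = ∀ (p : List⁺ (Fin m)) → IsWalk p → end p ≢ start p

  SingleSource : Fin n → Set
  SingleSource s = (∀ a → hd a ≢ s) × (∀ v → v ≢ s → ∃ λ a → hd a ≡ v)

  module _ (f : Fin m → ℕ) where

    Monotone : List⁺ (Fin m) → Set
    Monotone p = Linked (λ a b → f a ≤ f b) (toList p)

    minP : List⁺ (Fin m) → ℕ
    minP p = f (first p)

    maxP : List⁺ (Fin m) → ℕ
    maxP p = f (last p)

    -- an i-fan of v with respect to f and g; path P_j is indexed by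
    -- j' : Fin i with j = toℕ j' + 1
    record Fan (g : Fin n → ℕ) (v : Fin n) (i : ℕ) : Set where
      field
        P         : Fin i → List⁺ (Fin m)
        walk      : ∀ j → IsWalk (P j)
        monotone  : ∀ j → Monotone (P j)
        ends      : ∀ j → end (P j) ≡ v
        lowMin    : ∀ j → suc (toℕ j) ≤ minP (P j)
        minMax    : ∀ j → minP (P j) ≤ maxP (P j)
        maxHigh   : ∀ j → maxP (P j) ≤ i
        startOK   : ∀ j → minP (P j) ≤ g (start (P j))
        disjoint  : ∀ j j' → j ≢ j' → ∀ a → a ∈ toList (P j) → a ∉ toList (P j')

    record FanExtension (s : Fin n) (k : ℕ) (g : Fin n → ℕ) : Set where
      field
        range     : ∀ u → g u ≤ k
        source    : g s ≡ k
        fans      : ∀ u → u ≢ s → 0 < g u → Fan g u (g u)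
        arcCond   : ∀ a → f a ≤ g (tl a) ⊎ (∃ λ b → hd b ≡ tl a × f b ≡ f a)

update : {n : ℕ} → (Fin n → ℕ) → Fin n → ℕ → Fin n → ℕ
update g v i u with u ≟ v
... | yes _ = i
... | no  _ = g u

-- Raising g at v only makes the requirements on g easier to meet: the start
-- condition of every fan and the first alternative of the arc condition are
-- lower bounds on g, so they survive; the only new obligation is a g'(v)-fan
-- of v, which is exactly the given i-fan.
module Submission where

open import Defs
open import Data.Nat using (ℕ; _≤_; _<_)
open import Data.Nat.Properties using (≤-refl; ≤-trans; <⇒≤)
open import Data.Fin using (Fin; _≟_)
open import Data.Sum using (map₁)
open import Relation.Nullary using (yes; no; contradiction)
open import Relation.Binary.PropositionalEquality using (_≡_; _≢_; refl; sym; trans)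

update-≢ : ∀ {n} (g : Fin n → ℕ) v i {u} → u ≢ v → update g v i u ≡ g u
update-≢ g v i {u} u≢v with u ≟ v
... | yes u≡v = contradiction u≡v u≢v
... | no _    = refl

update-≥ : ∀ {n} (g : Fin n → ℕ) v {i} → g v ≤ i → ∀ u → g u ≤ update g v i u
update-≥ g v gv≤i u with u ≟ v
... | yes refl = gv≤i
... | no _     = ≤-refl

Fan-mono : ∀ {n m} (D : Digraph n m) (f : Fin m → ℕ) {g g' : Fin n → ℕ} →
           (∀ u → g u ≤ g' u) → ∀ {v i} → Fan D f g v i → Fan D f g' v i
Fan-mono D f g≤g' F = record
  { P        = P
  ; walk     = walk
  ; monotone = monotone
  ; ends     = ends
  ; lowMin   = lowMin
  ; minMax   = minMax
  ; maxHigh  = maxHigh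
  ; startOK  = λ j → ≤-trans (startOK j) (g≤g' _)
  ; disjoint = disjoint
  }
  where open Fan F

mainTheorem7 : ∀ {n m : ℕ} (D : Digraph n m) (s : Fin n) (k : ℕ)
                 (f : Fin m → ℕ) (g : Fin n → ℕ) (v : Fin n) (i : ℕ) →
                 Acyclic D → SingleSource D s → (∀ a → f a ≤ k) →
                 FanExtension D f s k g →
                 v ≢ s → g v < i → i ≤ k → Fan D f g v i →
                 FanExtension D f s k (update g v i)
mainTheorem7 D s k f g v i _ _ _ E v≢s gv<i i≤k Fᵥ = record
  { range   = range′
  ; source  = trans (update-≢ g v i (λ s≡v → v≢s (sym s≡v))) source
  ; fans    = fans′
  ; arcCond = λ a → map₁ (λ fa≤g → ≤-trans fa≤g (g≤g′ _)) (arcCond a)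
  }
  where
  open FanExtension E
  g≤g′ : ∀ u → g u ≤ update g v i u
  g≤g′ = update-≥ g v (<⇒≤ gv<i)

  range′ : ∀ u → update g v i u ≤ k
  range′ u with u ≟ v
  ... | yes _ = i≤k
  ... | no _  = range u

  fans′ : ∀ u → u ≢ s → 0 < update g v i u → Fan D f (update g v i) u (update g v i u)
  fans′ u u≢s pos with u ≟ v
  ... | yes refl = Fan-mono D f g≤g′ Fᵥ
  ... | no _     = Fan-mono D f g≤g′ (fans u u≢s pos)
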